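{- For every graph $G$, the linear rank-width of $G$ is at most the lettericity of $G$.
   Context: For a graph $G$ with adjacency matrix $M_G$ (over the binary field) and $X\subseteq V(G)$, let $\mathrm{cutrk}_G(X)$ be the rank over $GF(2)$ of the submatrix $M_G[X,V(G)\setminus X]$. For a linear ordering (bijection) $\pi:V(G)\to[n]$ of an $n$-vertex graph, its width is $\max_{1\le i\le n-1}\mathrm{cutrk}_G(\pi^{ -1}([i]))$; the linear rank-width of $G$ is the minimum width over all linear orderings. A decoder is a directed graph $D=(\Sigma,A)$ (loops allowed) on a finite alphabet. $G=(V,E)$ is a letter graph over $D$ if there exist $\ell:V\to\Sigma$ and a bijection $c:V\to[n]$ such that two distinct vertices $x,y$ are adjacent iff either $(\ell(x),\ell(y))\in A$ and $c(x)<c(y)$, or $(\ell(y),\ell(x))\in A$ and $c(y)<c(x)$. The lettericity of $G$ is the least $|\Sigma|$ of a decoder over which $G$ is a letter graph. -}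

module Defs where

open import Data.Nat using (ℕ; zero; suc; _<_; _≤_; _∸_)
open import Data.Fin using (Fin; toℕ) renaming (zero to fzero; suc to fsuc)
open import Data.Bool using (Bool; true; false; _xor_; _∧_)
open import Data.Product using (Σ; ∃; _×_; _,_)
open import Data.Sum using (_⊎_)
open import Relation.Binary.PropositionalEquality using (_≡_; _≢_)
open import Relation.Nullary using (¬_)
open import Function.Bundles using (_⤖_; Bijection)

-- Finite simple graphs on vertex set Fin n, given by their adjacency
-- matrix over GF(2) (= Bool with xor as addition, ∧ as multiplication).

record Graph (n : ℕ) : Set where
  field
    adj     : Fin n → Fin n → Bool
    sym     : ∀ x y → adj x y ≡ adj y x
    irrefl  : ∀ x → adj x x ≡ false

open Graph public

xorSum : ∀ {r} → (Fin r → Bool) → Bool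
xorSum {zero}  f = false
xorSum {suc r} f = f fzero xor xorSum (λ i → f (fsuc i))

-- The submatrix M_G[X, V∖X] has rows indexed by x ∈ X and columns
-- indexed by y ∉ X.  A family of r rows (x₁,…,x_r), all in X, is
-- linearly independent over GF(2) if the only coefficient vector c
-- with Σ_i c_i · M[x_i, y] = 0 for all columns y ∉ X is c = 0.
-- The rank of a matrix is the maximum size of a linearly independent
-- family of its rows; so "cutrk_G(X) ≤ k" says every linearly
-- independent family of rows of M_G[X, V∖X] has size at most k.

RowsIndependent : ∀ {n} → Graph n → (X : Fin n → Set) →
                  ∀ {r} → (Fin r → Fin n) → Set
RowsIndependent {n} G X {r} f =
  (c : Fin r → Bool) →
  ((y : Fin n) → ¬ X y → xorSum (λ i → c i ∧ adj G (f i) y) ≡ false) →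
  ∀ i → c i ≡ false

CutRankAtMost : ∀ {n} → Graph n → (X : Fin n → Set) → ℕ → Set
CutRankAtMost {n} G X k =
  ∀ (r : ℕ) (f : Fin r → Fin n) →
  (∀ i → X (f i)) → RowsIndependent G X f → r ≤ k

-- Linear orderings π : V → [n], represented as bijections Fin n ⤖ Fin n
-- (position toℕ (π v) ∈ {0,…,n-1}, i.e. 0-based).  π⁻¹([i]) is the set
-- of vertices at the first i positions.

Prefix : ∀ {n} → (Fin n ⤖ Fin n) → ℕ → Fin n → Set
Prefix π i v = toℕ (Bijection.to π v) < i

WidthAtMost : ∀ {n} → Graph n → (Fin n ⤖ Fin n) → ℕ → Set
WidthAtMost {n} G π k =
  ∀ (i : ℕ) → 1 ≤ i → i ≤ n ∸ 1 → CutRankAtMost G (Prefix π i) k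

LinearRankWidthAtMost : ∀ {n} → Graph n → ℕ → Set
LinearRankWidthAtMost {n} G k = Σ (Fin n ⤖ Fin n) λ π → WidthAtMost G π k

-- Decoders on an alphabet of size k (alphabet Fin k), arcs given by a
-- Boolean relation (loops allowed).

Decoder : ℕ → Set
Decoder k = Fin k → Fin k → Bool

IsLetterGraph : ∀ {n k} → Graph n → Decoder k → Set
IsLetterGraph {n} {k} G D =
  Σ (Fin n → Fin k) λ ℓ → Σ (Fin n ⤖ Fin n) λ c →
    ∀ (x y : Fin n) → x ≢ y →
      (adj G x y ≡ true →
         (D (ℓ x) (ℓ y) ≡ true × toℕ (Bijection.to c x) < toℕ (Bijection.to c y))
       ⊎ (D (ℓ y) (ℓ x) ≡ true × toℕ (Bijection.to c y) < toℕ (Bijection.to c x)))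
    × (((D (ℓ x) (ℓ y) ≡ true × toℕ (Bijection.to c x) < toℕ (Bijection.to c y))
       ⊎ (D (ℓ y) (ℓ x) ≡ true × toℕ (Bijection.to c y) < toℕ (Bijection.to c x)))
         → adj G x y ≡ true)

LettericityAtMost : ∀ {n} → Graph n → ℕ → Set
LettericityAtMost G k = Σ (Decoder k) λ D → IsLetterGraph G D

{-# OPTIONS --safe #-}
-- Order the vertices as in a letter-graph representation (ℓ, c) over a
-- decoder D on k letters. Across the cut after any prefix X, a vertex x ∈ X
-- is adjacent to a later vertex y exactly when D (ℓ x) (ℓ y), so the row of
-- x in M_G[X, V∖X] depends only on its letter. Two rows with the same letter
-- sum to zero over GF(2); hence an independent family of rows has pairwise
-- distinct letters and at most k members.
module Submission where

open import Defs hiding (sym)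
open import Algebra.Bundles using (CommutativeRing)
open import Data.Bool using (Bool; true; false; _xor_; _∧_)
open import Data.Bool.Properties
  using (xor-same; xor-identityʳ; ∧-distribʳ-xor; ⇔→≡; xor-∧-commutativeRing)
open import Algebra.Properties.CommutativeSemigroup
  (CommutativeRing.+-commutativeSemigroup xor-∧-commutativeRing)
  using (interchange)
open import Data.Fin using (Fin; toℕ) renaming (zero to fzero; suc to fsuc)
open import Data.Fin.Properties using (_≟_; injective⇒≤)
open import Data.Nat using (ℕ; zero; suc; _<_)
open import Data.Nat.Properties using (<-irrefl; <-asym; <-≤-trans; ≮⇒≥)
open import Data.Product using (_,_; proj₁; proj₂)
open import Data.Sum using (inj₁; inj₂)
open import Function using (_∘_)
open import Function.Bundles using (_⤖_; Bijection; mk⇔)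
open import Function.Definitions using (Injective)
open import Relation.Binary.PropositionalEquality
  using (_≡_; _≢_; refl; sym; trans; cong; cong₂; module ≡-Reasoning)
open import Relation.Nullary using (¬_; does; yes; no; contradiction)
open import Relation.Nullary.Decidable using (dec-true; dec-false)

δ : ∀ {r} → Fin r → Fin r → Bool
δ i m = does (m ≟ i)

xorSum-cong : ∀ {r} {f g : Fin r → Bool} → (∀ m → f m ≡ g m) → xorSum f ≡ xorSum g
xorSum-cong {zero}  f≡g = refl
xorSum-cong {suc r} f≡g = cong₂ _xor_ (f≡g fzero) (xorSum-cong (f≡g ∘ fsuc))

xorSum-false : ∀ {r} → xorSum {r} (λ _ → false) ≡ false
xorSum-false {zero}  = refl
xorSum-false {suc r} = xorSum-false {r}

xorSum-xor : ∀ {r} (f g : Fin r → Bool) →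
             xorSum (λ m → f m xor g m) ≡ xorSum f xor xorSum g
xorSum-xor {zero}  f g = refl
xorSum-xor {suc r} f g = begin
  (f fzero xor g fzero) xor xorSum (λ m → f (fsuc m) xor g (fsuc m))
    ≡⟨ cong ((f fzero xor g fzero) xor_) (xorSum-xor (f ∘ fsuc) (g ∘ fsuc)) ⟩
  (f fzero xor g fzero) xor (xorSum (f ∘ fsuc) xor xorSum (g ∘ fsuc))
    ≡⟨ interchange (f fzero) (g fzero) (xorSum (f ∘ fsuc)) (xorSum (g ∘ fsuc)) ⟩
  xorSum f xor xorSum g ∎
  where open ≡-Reasoning

xorSum-δ : ∀ {r} (i : Fin r) (g : Fin r → Bool) → xorSum (λ m → δ i m ∧ g m) ≡ g i
xorSum-δ {suc r} fzero g = trans (cong (g fzero xor_) (xorSum-false {r})) (xor-identityʳ (g fzero))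
xorSum-δ {suc r} (fsuc i) g = xorSum-δ i (g ∘ fsuc)

xorSum-δ-pair : ∀ {r} (a b : Fin r) (g : Fin r → Bool) → g a ≡ g b →
                xorSum (λ m → (δ a m xor δ b m) ∧ g m) ≡ false
xorSum-δ-pair a b g ga≡gb = begin
  xorSum (λ m → (δ a m xor δ b m) ∧ g m)
    ≡⟨ xorSum-cong (λ m → ∧-distribʳ-xor (g m) (δ a m) (δ b m)) ⟩
  xorSum (λ m → (δ a m ∧ g m) xor (δ b m ∧ g m))
    ≡⟨ xorSum-xor (λ m → δ a m ∧ g m) (λ m → δ b m ∧ g m) ⟩
  xorSum (λ m → δ a m ∧ g m) xor xorSum (λ m → δ b m ∧ g m)
    ≡⟨ cong₂ _xor_ (xorSum-δ a g) (xorSum-δ b g) ⟩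
  g a xor g b
    ≡⟨ cong (_xor g b) ga≡gb ⟩
  g b xor g b
    ≡⟨ xor-same (g b) ⟩
  false ∎
  where open ≡-Reasoning

repeatedRow⇒¬RowsIndependent :
  ∀ {n} (G : Graph n) (X : Fin n → Set) {r} (f : Fin r → Fin n) {a b : Fin r} →
  a ≢ b → (∀ y → ¬ X y → adj G (f a) y ≡ adj G (f b) y) → ¬ RowsIndependent G X f
repeatedRow⇒¬RowsIndependent G X {r} f {a} {b} a≢b sameRow independent =
  contradiction (trans (sym coefficient-a) (independent coefficient rowSum≡0 a)) λ ()
  where
  coefficient : Fin r → Bool
  coefficient m = δ a m xor δ b m

  coefficient-a : coefficient a ≡ true
  coefficient-a = cong₂ _xor_ (dec-true (a ≟ a) refl) (dec-false (a ≟ b) a≢b)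

  rowSum≡0 : ∀ y → ¬ X y → xorSum (λ m → coefficient m ∧ adj G (f m) y) ≡ false
  rowSum≡0 y y∉X = xorSum-δ-pair a b (λ m → adj G (f m) y) (sameRow y y∉X)

rowLabelling⇒CutRankAtMost :
  ∀ {n k} (G : Graph n) (X : Fin n → Set) (label : Fin n → Fin k) →
  (∀ x x′ → X x → X x′ → label x ≡ label x′ → ∀ y → ¬ X y → adj G x y ≡ adj G x′ y) →
  CutRankAtMost G X k
rowLabelling⇒CutRankAtMost G X label sameRow r f f∈X independent =
  injective⇒≤ label∘f-injective
  where
  label∘f-injective : Injective _≡_ _≡_ (label ∘ f)
  label∘f-injective {a} {b} sameLabel with a ≟ b
  ... | yes a≡b = a≡b
  ... | no  a≢b = contradiction independent
    (repeatedRow⇒¬RowsIndependent G X f a≢b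
      (sameRow (f a) (f b) (f∈X a) (f∈X b) sameLabel))

module LetterGraph {n k} (G : Graph n) (D : Decoder k) (L : IsLetterGraph G D) where

  letter : Fin n → Fin k
  letter = proj₁ L

  order : Fin n ⤖ Fin n
  order = proj₁ (proj₂ L)

  position : Fin n → ℕ
  position v = toℕ (Bijection.to order v)

  adj-forward : ∀ x y → position x < position y → adj G x y ≡ D (letter x) (letter y)
  adj-forward x y x<y = ⇔→≡ (mk⇔ edge⇒arc arc⇒edge)
    where
    x≢y : x ≢ y
    x≢y refl = <-irrefl refl x<y

    edge⇒arc : adj G x y ≡ true → D (letter x) (letter y) ≡ true
    edge⇒arc edge with proj₁ (proj₂ (proj₂ L) x y x≢y) edge
    ... | inj₁ (arc , _)   = arc
    ... | inj₂ (_ , y<x) = contradiction y<x (<-asym x<y)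

    arc⇒edge : D (letter x) (letter y) ≡ true → adj G x y ≡ true
    arc⇒edge arc = proj₂ (proj₂ (proj₂ L) x y x≢y) (inj₁ (arc , x<y))

  prefixRow-determinedByLetter :
    ∀ i x x′ → Prefix order i x → Prefix order i x′ → letter x ≡ letter x′ →
    ∀ y → ¬ Prefix order i y → adj G x y ≡ adj G x′ y
  prefixRow-determinedByLetter i x x′ x∈X x′∈X sameLetter y y∉X = begin
    adj G x y               ≡⟨ adj-forward x y (<-≤-trans x∈X (≮⇒≥ y∉X)) ⟩
    D (letter x) (letter y)  ≡⟨ cong (λ a → D a (letter y)) sameLetter ⟩
    D (letter x′) (letter y) ≡⟨ sym (adj-forward x′ y (<-≤-trans x′∈X (≮⇒≥ y∉X))) ⟩
    adj G x′ y ∎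
    where open ≡-Reasoning

proposition2p3 : ∀ (n : ℕ) (G : Graph n) (k : ℕ) →
    LettericityAtMost G k → LinearRankWidthAtMost G k
proposition2p3 n G k (D , L) = order , λ i _ _ →
  rowLabelling⇒CutRankAtMost G (Prefix order i) letter (prefixRow-determinedByLetter i)
  where open LetterGraph G D L
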